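{- Let $\Theta$ be a System $\mathsf{F}_\wedge$ context, $\Theta\vdash S$ and $\Theta,X<:\top\vdash T$ types, and $\Theta\vdash t:\forall X.T[X\wedge S/X^-]$. If $Y\notin\mathrm{dom}(\Theta)$, then $\Theta\vdash t=\Lambda Y.\,t\{Y\wedge S\}:\forall X.T[X\wedge S/X^-]$ is derivable in the equational theory of System $\mathsf{F}_\wedge$.
   Context: System $\mathsf{F}_\wedge$. Types: $T ::= \top\mid X\mid T\to T\mid \forall X.T\mid T\wedge T$ (up to $\alpha$-conversion). Contexts are finite sequences of $X<:T$ and $x:T$. Subtyping $\Theta\vdash S<:T$: (Var) $\Theta,X<:T,\Theta'\vdash X<:T$; (Top); (Refl); (Trans); ($\to$) contravariant/covariant; ($\forall$) from $\Theta,X<:\top\vdash S<:T$ infer $\Theta\vdash\forall X.S<:\forall X.T$; $S\wedge S'<:S$, $S\wedge S'<:S'$, and $T<:S\wedge S'$ from $T<:S$ and $T<:S'$. Terms: $t ::= \mathsf{top}\mid x\mid\lambda(x:T).t\mid\Lambda X.t\mid t\,t\mid t\{T\}$, typed by the usual rules ($\mathsf{top}:\top$, variables, subsumption, $\lambda$-intro, application, $\Lambda X.t:\forall X.T$ from $\Theta,X<:\top\vdash t:T$, and $t\{S'\}:T[S'/X]$ from $t:\forall X.T$). Equational judgments $\Theta\vdash t=t':T$ are generated by: equality of all terms at $\top$; reflexivity, symmetry, transitivity; $\beta_1$, $\eta_1$; $\beta_2$: $(\Lambda X.t)\{R\}=t[R/X]:T[R/X]$ for $\Theta,X<:\top\vdash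 t:T$; $\eta_2$: $\Lambda Y.(t\{Y\})=t:\forall X.T$ for $t:\forall X.T$, $Y\notin\mathrm{dom}(\Theta)$; congruence rules for $\lambda$, $\Lambda$ (from $\Theta,X<:\top\vdash t=t':T$ infer $\Lambda X.t=\Lambda X.t':\forall X.T$) and application; $\mathit{app}_2$: from $\Theta\vdash t=t':\forall X.T$, $\Theta\vdash T[R/X]<:T'$ and $\Theta\vdash T[R'/X]<:T'$ infer $\Theta\vdash t\{R\}=t'\{R'\}:T'$. Mixed substitution: $T[(S_-,S_+)/X]$ replaces negative occurrences of $X$ in $T$ by $S_-$ and positive ones by $S_+$, defined by $X[(S_-,S_+)/X]=S_+$, $Y[(S_-,S_+)/X]=Y$ for $Y\neq X$, $\top[(S_-,S_+)/X]=\top$, $(T\to T')[(S_-,S_+)/X]=T[(S_+,S_-)/X]\to T'[(S_-,S_+)/X]$, $(\forall Y.T)[(S_-,S_+)/X]=\forall Y.T[(S_-,S_+)/X]$, $(T\wedge T')[(S_-,S_+)/X]=T[(S_-,S_+)/X]\wedge T'[(S_-,S_+)/X]$ (bound variables renamed to avoid capture). $T[S/X^-]$ abbreviates $T[(S,X)/X]$. -}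

module Defs where

open import Data.Nat using (ℕ; zero; suc)
open import Data.Fin using (Fin; zero; suc)

private
  variable
    n n' m m' : ℕ

-- Types of System F∧, well-scoped de Bruijn representation
-- (α-equivalence is syntactic identity).  Ty n = types with n free
-- type variables; tvar zero is the most recently bound variable.

infixr 7 _⇒_
infixl 8 _∧_

data Ty (n : ℕ) : Set where
  ⊤    : Ty n
  tvar : Fin n → Ty n
  _⇒_  : Ty n → Ty n → Ty n
  ∀'   : Ty (suc n) → Ty n
  _∧_  : Ty n → Ty n → Ty n

extR : (Fin n → Fin m) → Fin (suc n) → Fin (suc m)
extR ρ zero    = zero
extR ρ (suc i) = suc (ρ i)

renT : (Fin n → Fin m) → Ty n → Ty m
renT ρ ⊤        = ⊤
renT ρ (tvar i) = tvar (ρ i)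
renT ρ (A ⇒ B)  = renT ρ A ⇒ renT ρ B
renT ρ (∀' A)   = ∀' (renT (extR ρ) A)
renT ρ (A ∧ B)  = renT ρ A ∧ renT ρ B

wkT : Ty n → Ty (suc n)
wkT = renT suc

extS : (Fin n → Ty m) → Fin (suc n) → Ty (suc m)
extS σ zero    = tvar zero
extS σ (suc i) = wkT (σ i)

subT : (Fin n → Ty m) → Ty n → Ty m
subT σ ⊤        = ⊤
subT σ (tvar i) = σ i
subT σ (A ⇒ B)  = subT σ A ⇒ subT σ B
subT σ (∀' A)   = ∀' (subT (extS σ) A)
subT σ (A ∧ B)  = subT σ A ∧ subT σ B

single : Ty n → Fin (suc n) → Ty n
single S zero    = S
single S (suc i) = tvar i

_[_]T : Ty (suc n) → Ty n → Ty n
T [ S ]T = subT (single S) T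

-- Mixed substitution: negative occurrences of variable i are replaced by
-- σ₋ i, positive ones by σ₊ i (the roles swap to the left of an arrow).

msubT : (σ₋ σ₊ : Fin n → Ty m) → Ty n → Ty m
msubT σ₋ σ₊ ⊤        = ⊤
msubT σ₋ σ₊ (tvar i) = σ₊ i
msubT σ₋ σ₊ (A ⇒ B)  = msubT σ₊ σ₋ A ⇒ msubT σ₋ σ₊ B
msubT σ₋ σ₊ (∀' A)   = ∀' (msubT (extS σ₋) (extS σ₊) A)
msubT σ₋ σ₊ (A ∧ B)  = msubT σ₋ σ₊ A ∧ msubT σ₋ σ₊ B

point : Ty (suc n) → Fin (suc n) → Ty (suc n)
point S zero    = S
point S (suc i) = tvar (suc i)

_[_,_/X] : Ty (suc n) → Ty (suc n) → Ty (suc n) → Ty (suc n)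
T [ S₋ , S₊ /X] = msubT (point S₋) (point S₊) T

_[_/X⁻] : Ty (suc n) → Ty (suc n) → Ty (suc n)
T [ S /X⁻] = T [ S , tvar zero /X]

infixl 5 _,<:_ _,∶_

data Ctx : ℕ → ℕ → Set where
  ∅     : Ctx 0 0
  _,<:_ : Ctx n m → Ty n → Ctx (suc n) m
  _,∶_  : Ctx n m → Ty n → Ctx n (suc m)

bound : Ctx n m → Fin n → Ty n
bound (Θ ,<: T) zero    = wkT T
bound (Θ ,<: T) (suc i) = wkT (bound Θ i)
bound (Θ ,∶ T)  i       = bound Θ i

typeOf : Ctx n m → Fin m → Ty n
typeOf (Θ ,<: T) x       = wkT (typeOf Θ x)
typeOf (Θ ,∶ T)  zero    = T
typeOf (Θ ,∶ T)  (suc x) = typeOf Θ x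

infixl 9 _·_
infixl 9 _⟨_⟩

data Tm (n m : ℕ) : Set where
  top  : Tm n m
  var  : Fin m → Tm n m
  ƛ    : Ty n → Tm n (suc m) → Tm n m
  Λ    : Tm (suc n) m → Tm n m
  _·_  : Tm n m → Tm n m → Tm n m
  _⟨_⟩ : Tm n m → Ty n → Tm n m

renTmT : (Fin n → Fin n') → Tm n m → Tm n' m
renTmT ρ top       = top
renTmT ρ (var x)   = var x
renTmT ρ (ƛ A t)   = ƛ (renT ρ A) (renTmT ρ t)
renTmT ρ (Λ t)     = Λ (renTmT (extR ρ) t)
renTmT ρ (t · u)   = renTmT ρ t · renTmT ρ u
renTmT ρ (t ⟨ A ⟩) = renTmT ρ t ⟨ renT ρ A ⟩

wkTmT : Tm n m → Tm (suc n) m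
wkTmT = renTmT suc

subTmT : (Fin n → Ty n') → Tm n m → Tm n' m
subTmT σ top       = top
subTmT σ (var x)   = var x
subTmT σ (ƛ A t)   = ƛ (subT σ A) (subTmT σ t)
subTmT σ (Λ t)     = Λ (subTmT (extS σ) t)
subTmT σ (t · u)   = subTmT σ t · subTmT σ u
subTmT σ (t ⟨ A ⟩) = subTmT σ t ⟨ subT σ A ⟩

_[_]ᵀ : Tm (suc n) m → Ty n → Tm n m
t [ R ]ᵀ = subTmT (single R) t

renTm : (Fin m → Fin m') → Tm n m → Tm n m'
renTm ρ top       = top
renTm ρ (var x)   = var (ρ x)
renTm ρ (ƛ A t)   = ƛ A (renTm (extR ρ) t)
renTm ρ (Λ t)     = Λ (renTm ρ t)
renTm ρ (t · u)   = renTm ρ t · renTm ρ u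
renTm ρ (t ⟨ A ⟩) = renTm ρ t ⟨ A ⟩

wkTm : Tm n m → Tm n (suc m)
wkTm = renTm suc

extTm : (Fin m → Tm n m') → Fin (suc m) → Tm n (suc m')
extTm σ zero    = var zero
extTm σ (suc x) = wkTm (σ x)

subTm : (Fin m → Tm n m') → Tm n m → Tm n m'
subTm σ top       = top
subTm σ (var x)   = σ x
subTm σ (ƛ A t)   = ƛ A (subTm (extTm σ) t)
subTm σ (Λ t)     = Λ (subTm (λ x → wkTmT (σ x)) t)
subTm σ (t · u)   = subTm σ t · subTm σ u
subTm σ (t ⟨ A ⟩) = subTm σ t ⟨ A ⟩

singleTm : Tm n m → Fin (suc m) → Tm n m
singleTm u zero    = u
singleTm u (suc x) = var x

_[_]ₜ : Tm n (suc m) → Tm n m → Tm n m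
t [ u ]ₜ = subTm (singleTm u) t

infix 4 _⊢_<:_ _⊢_∶_ _⊢_≈_∶_

data _⊢_<:_ {n m : ℕ} : Ctx n m → Ty n → Ty n → Set where
  S-Var   : ∀ {Θ} (X : Fin n) → Θ ⊢ tvar X <: bound Θ X
  S-Top   : ∀ {Θ S} → Θ ⊢ S <: ⊤
  S-Refl  : ∀ {Θ S} → Θ ⊢ S <: S
  S-Trans : ∀ {Θ S U T} → Θ ⊢ S <: U → Θ ⊢ U <: T → Θ ⊢ S <: T
  S-Arrow : ∀ {Θ S S' T T'} → Θ ⊢ T <: S → Θ ⊢ S' <: T' →
            Θ ⊢ S ⇒ S' <: T ⇒ T'
  S-All   : ∀ {Θ S T} → (Θ ,<: ⊤) ⊢ S <: T → Θ ⊢ ∀' S <: ∀' T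
  S-∧₁    : ∀ {Θ S S'} → Θ ⊢ S ∧ S' <: S
  S-∧₂    : ∀ {Θ S S'} → Θ ⊢ S ∧ S' <: S'
  S-∧     : ∀ {Θ T S S'} → Θ ⊢ T <: S → Θ ⊢ T <: S' → Θ ⊢ T <: S ∧ S'

data _⊢_∶_ {n m : ℕ} : Ctx n m → Tm n m → Ty n → Set where
  T-Top  : ∀ {Θ} → Θ ⊢ top ∶ ⊤
  T-Var  : ∀ {Θ} (x : Fin m) → Θ ⊢ var x ∶ typeOf Θ x
  T-Sub  : ∀ {Θ t S T} → Θ ⊢ t ∶ S → Θ ⊢ S <: T → Θ ⊢ t ∶ T
  T-Abs  : ∀ {Θ S T t} → (Θ ,∶ S) ⊢ t ∶ T → Θ ⊢ ƛ S t ∶ S ⇒ T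
  T-App  : ∀ {Θ S T t u} → Θ ⊢ t ∶ S ⇒ T → Θ ⊢ u ∶ S → Θ ⊢ t · u ∶ T
  T-TAbs : ∀ {Θ T t} → (Θ ,<: ⊤) ⊢ t ∶ T → Θ ⊢ Λ t ∶ ∀' T
  T-TApp : ∀ {Θ T t} {S' : Ty n} → Θ ⊢ t ∶ ∀' T → Θ ⊢ t ⟨ S' ⟩ ∶ T [ S' ]T

data _⊢_≈_∶_ {n m : ℕ} : Ctx n m → Tm n m → Tm n m → Ty n → Set where
  E-Top   : ∀ {Θ t t'} → Θ ⊢ t ∶ ⊤ → Θ ⊢ t' ∶ ⊤ → Θ ⊢ t ≈ t' ∶ ⊤
  E-Refl  : ∀ {Θ t T} → Θ ⊢ t ∶ T → Θ ⊢ t ≈ t ∶ T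
  E-Sym   : ∀ {Θ t t' T} → Θ ⊢ t ≈ t' ∶ T → Θ ⊢ t' ≈ t ∶ T
  E-Trans : ∀ {Θ t t' t'' T} → Θ ⊢ t ≈ t' ∶ T → Θ ⊢ t' ≈ t'' ∶ T →
            Θ ⊢ t ≈ t'' ∶ T
  E-β₁    : ∀ {Θ S T t u} → (Θ ,∶ S) ⊢ t ∶ T → Θ ⊢ u ∶ S →
            Θ ⊢ ƛ S t · u ≈ t [ u ]ₜ ∶ T
  E-η₁    : ∀ {Θ S T t} → Θ ⊢ t ∶ S ⇒ T →
            Θ ⊢ ƛ S (wkTm t · var zero) ≈ t ∶ S ⇒ T
  E-β₂    : ∀ {Θ T t} {R : Ty n} → (Θ ,<: ⊤) ⊢ t ∶ T →
            Θ ⊢ Λ t ⟨ R ⟩ ≈ t [ R ]ᵀ ∶ T [ R ]T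
  E-η₂    : ∀ {Θ T t} → Θ ⊢ t ∶ ∀' T →
            Θ ⊢ Λ (wkTmT t ⟨ tvar zero ⟩) ≈ t ∶ ∀' T
  E-Abs   : ∀ {Θ S T t t'} → (Θ ,∶ S) ⊢ t ≈ t' ∶ T →
            Θ ⊢ ƛ S t ≈ ƛ S t' ∶ S ⇒ T
  E-TAbs  : ∀ {Θ T t t'} → (Θ ,<: ⊤) ⊢ t ≈ t' ∶ T →
            Θ ⊢ Λ t ≈ Λ t' ∶ ∀' T
  E-App   : ∀ {Θ S T t t' u u'} → Θ ⊢ t ≈ t' ∶ S ⇒ T → Θ ⊢ u ≈ u' ∶ S →
            Θ ⊢ t · u ≈ t' · u' ∶ T
  E-app₂  : ∀ {Θ T T' t t'} {R R' : Ty n} → Θ ⊢ t ≈ t' ∶ ∀' T →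
            Θ ⊢ T [ R ]T <: T' → Θ ⊢ T [ R' ]T <: T' →
            Θ ⊢ t ⟨ R ⟩ ≈ t' ⟨ R' ⟩ ∶ T'

module Submission where

-- η₂ gives t = ΛY. t{Y}, and app₂ replaces t{Y} by t{Y ∧ S} as soon as both
-- instances of U = T[X ∧ S/X⁻] are subtypes of U. For Y this is reflexivity;
-- for Y ∧ S, the instance U[X ∧ S/X] is T with its negative occurrences of X
-- replaced by (X ∧ S) ∧ S and its positive ones by X ∧ S, and by monotonicity
-- of mixed substitution it lies below T[(X ∧ S, X)/X] = U, because
-- X ∧ S <: (X ∧ S) ∧ S and X ∧ S <: X.

open import Defs
open import Data.Nat using (ℕ; zero; suc)
open import Data.Fin using (Fin; zero; suc)
open import Function using (_∘_; id)
open import Relation.Binary.PropositionalEquality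

private
  variable
    j k l n m : ℕ

extR-cong : {ρ ρ' : Fin k → Fin l} → ρ ≗ ρ' → extR ρ ≗ extR ρ'
extR-cong e zero    = refl
extR-cong e (suc i) = cong suc (e i)

extS-cong : {σ σ' : Fin k → Ty l} → σ ≗ σ' → extS σ ≗ extS σ'
extS-cong e zero    = refl
extS-cong e (suc i) = cong wkT (e i)

renT-cong : {ρ ρ' : Fin k → Fin l} → ρ ≗ ρ' → renT ρ ≗ renT ρ'
renT-cong e ⊤        = refl
renT-cong e (tvar i) = cong tvar (e i)
renT-cong e (A ⇒ B)  = cong₂ _⇒_ (renT-cong e A) (renT-cong e B)
renT-cong e (∀' A)   = cong ∀' (renT-cong (extR-cong e) A)
renT-cong e (A ∧ B)  = cong₂ _∧_ (renT-cong e A) (renT-cong e B)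

subT-cong : {σ σ' : Fin k → Ty l} → σ ≗ σ' → subT σ ≗ subT σ'
subT-cong e ⊤        = refl
subT-cong e (tvar i) = e i
subT-cong e (A ⇒ B)  = cong₂ _⇒_ (subT-cong e A) (subT-cong e B)
subT-cong e (∀' A)   = cong ∀' (subT-cong (extS-cong e) A)
subT-cong e (A ∧ B)  = cong₂ _∧_ (subT-cong e A) (subT-cong e B)

msubT-cong : {σ₋ σ₋' σ₊ σ₊' : Fin k → Ty l} → σ₋ ≗ σ₋' → σ₊ ≗ σ₊' →
             msubT σ₋ σ₊ ≗ msubT σ₋' σ₊'
msubT-cong e f ⊤        = refl
msubT-cong e f (tvar i) = f i
msubT-cong e f (A ⇒ B)  = cong₂ _⇒_ (msubT-cong f e A) (msubT-cong e f B)
msubT-cong e f (∀' A)   = cong ∀' (msubT-cong (extS-cong e) (extS-cong f) A)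
msubT-cong e f (A ∧ B)  = cong₂ _∧_ (msubT-cong e f A) (msubT-cong e f B)

extR-id : {ρ : Fin k → Fin k} → ρ ≗ id → extR ρ ≗ id
extR-id e zero    = refl
extR-id e (suc i) = cong suc (e i)

renT-id : {ρ : Fin k → Fin k} → ρ ≗ id → ∀ A → renT ρ A ≡ A
renT-id e ⊤        = refl
renT-id e (tvar i) = cong tvar (e i)
renT-id e (A ⇒ B)  = cong₂ _⇒_ (renT-id e A) (renT-id e B)
renT-id e (∀' A)   = cong ∀' (renT-id (extR-id e) A)
renT-id e (A ∧ B)  = cong₂ _∧_ (renT-id e A) (renT-id e B)

subT-tvar : {σ : Fin k → Ty l} {ρ : Fin k → Fin l} → σ ≗ tvar ∘ ρ → subT σ ≗ renT ρ
subT-tvar e ⊤        = refl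
subT-tvar e (tvar i) = e i
subT-tvar e (A ⇒ B)  = cong₂ _⇒_ (subT-tvar e A) (subT-tvar e B)
subT-tvar e (∀' A)   = cong ∀' (subT-tvar (λ { zero → refl ; (suc i) → cong wkT (e i) }) A)
subT-tvar e (A ∧ B)  = cong₂ _∧_ (subT-tvar e A) (subT-tvar e B)

renT-∘ : (ρ : Fin l → Fin j) (ρ' : Fin k → Fin l) → renT ρ ∘ renT ρ' ≗ renT (ρ ∘ ρ')
renT-∘ ρ ρ' ⊤        = refl
renT-∘ ρ ρ' (tvar i) = refl
renT-∘ ρ ρ' (A ⇒ B)  = cong₂ _⇒_ (renT-∘ ρ ρ' A) (renT-∘ ρ ρ' B)
renT-∘ ρ ρ' (∀' A)   =
  cong ∀' (trans (renT-∘ (extR ρ) (extR ρ') A)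
                 (renT-cong (λ { zero → refl ; (suc i) → refl }) A))
renT-∘ ρ ρ' (A ∧ B)  = cong₂ _∧_ (renT-∘ ρ ρ' A) (renT-∘ ρ ρ' B)

renT-extR-wkT : (ρ : Fin k → Fin l) (A : Ty k) → renT (extR ρ) (wkT A) ≡ wkT (renT ρ A)
renT-extR-wkT ρ A = trans (renT-∘ (extR ρ) suc A) (sym (renT-∘ suc ρ A))

subT-renT : (σ : Fin l → Ty j) (ρ : Fin k → Fin l) → subT σ ∘ renT ρ ≗ subT (σ ∘ ρ)
subT-renT σ ρ ⊤        = refl
subT-renT σ ρ (tvar i) = refl
subT-renT σ ρ (A ⇒ B)  = cong₂ _⇒_ (subT-renT σ ρ A) (subT-renT σ ρ B)
subT-renT σ ρ (∀' A)   =
  cong ∀' (trans (subT-renT (extS σ) (extR ρ) A)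
                 (subT-cong (λ { zero → refl ; (suc i) → refl }) A))
subT-renT σ ρ (A ∧ B)  = cong₂ _∧_ (subT-renT σ ρ A) (subT-renT σ ρ B)

renT-subT : (ρ : Fin l → Fin j) (σ : Fin k → Ty l) → renT ρ ∘ subT σ ≗ subT (renT ρ ∘ σ)
renT-subT ρ σ ⊤        = refl
renT-subT ρ σ (tvar i) = refl
renT-subT ρ σ (A ⇒ B)  = cong₂ _⇒_ (renT-subT ρ σ A) (renT-subT ρ σ B)
renT-subT ρ σ (∀' A)   =
  cong ∀' (trans (renT-subT (extR ρ) (extS σ) A)
                 (subT-cong (λ { zero → refl ; (suc i) → renT-extR-wkT ρ (σ i) }) A))
renT-subT ρ σ (A ∧ B)  = cong₂ _∧_ (renT-subT ρ σ A) (renT-subT ρ σ B)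

subT-extS-wkT : (τ : Fin l → Ty j) (A : Ty l) → subT (extS τ) (wkT A) ≡ wkT (subT τ A)
subT-extS-wkT τ A = trans (subT-renT (extS τ) suc A) (sym (renT-subT suc τ A))

subT-msubT : (τ : Fin l → Ty j) (σ₋ σ₊ : Fin k → Ty l) →
             subT τ ∘ msubT σ₋ σ₊ ≗ msubT (subT τ ∘ σ₋) (subT τ ∘ σ₊)
subT-msubT τ σ₋ σ₊ ⊤        = refl
subT-msubT τ σ₋ σ₊ (tvar i) = refl
subT-msubT τ σ₋ σ₊ (A ⇒ B)  = cong₂ _⇒_ (subT-msubT τ σ₊ σ₋ A) (subT-msubT τ σ₋ σ₊ B)
subT-msubT τ σ₋ σ₊ (∀' A)   =
  cong ∀' (trans (subT-msubT (extS τ) (extS σ₋) (extS σ₊) A)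
                 (msubT-cong (extS-subT σ₋) (extS-subT σ₊) A))
  where
    extS-subT : (σ : Fin _ → Ty _) → subT (extS τ) ∘ extS σ ≗ extS (subT τ ∘ σ)
    extS-subT σ zero    = refl
    extS-subT σ (suc i) = subT-extS-wkT τ (σ i)
subT-msubT τ σ₋ σ₊ (A ∧ B)  = cong₂ _∧_ (subT-msubT τ σ₋ σ₊ A) (subT-msubT τ σ₋ σ₊ B)

renT-[]T : (ρ : Fin k → Fin l) (A : Ty (suc k)) (R : Ty k) →
           renT (extR ρ) A [ renT ρ R ]T ≡ renT ρ (A [ R ]T)
renT-[]T ρ A R =
  trans (subT-renT (single (renT ρ R)) (extR ρ) A)
        (trans (subT-cong (λ { zero → refl ; (suc i) → refl }) A)
               (sym (renT-subT ρ (single R) A)))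

renT-extR-suc-[]T : (A R : Ty (suc k)) → renT (extR suc) A [ R ]T ≡ subT (point R) A
renT-extR-suc-[]T A R =
  trans (subT-renT (single R) (extR suc) A)
        (subT-cong (λ { zero → refl ; (suc i) → refl }) A)

subT-point-tvar-zero : (A : Ty (suc k)) → subT (point (tvar zero)) A ≡ A
subT-point-tvar-zero A =
  trans (subT-tvar {ρ = id} (λ { zero → refl ; (suc i) → refl }) A) (renT-id (λ _ → refl) A)

subT-point-wkT : (R : Ty (suc k)) (A : Ty k) → subT (point R) (wkT A) ≡ wkT A
subT-point-wkT R A = trans (subT-renT (point R) suc A) (subT-tvar (λ _ → refl) A)

record _∶_⇒ᶜ_ (ρ : Fin n → Fin l) (Θ : Ctx n m) (Θ' : Ctx l m) : Set where
  field
    typeOf-ren : ∀ x → typeOf Θ' x ≡ renT ρ (typeOf Θ x)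
    bound-ren  : ∀ i → bound Θ' (ρ i) ≡ renT ρ (bound Θ i)
open _∶_⇒ᶜ_

wk⇒ᶜ : (Θ : Ctx n m) → suc ∶ Θ ⇒ᶜ (Θ ,<: ⊤)
typeOf-ren (wk⇒ᶜ Θ) x = refl
bound-ren  (wk⇒ᶜ Θ) i = refl

ext<:⇒ᶜ : {ρ : Fin n → Fin l} {Θ : Ctx n m} {Θ' : Ctx l m} →
          ρ ∶ Θ ⇒ᶜ Θ' → extR ρ ∶ (Θ ,<: ⊤) ⇒ᶜ (Θ' ,<: ⊤)
typeOf-ren (ext<:⇒ᶜ {ρ = ρ} {Θ} r) x =
  trans (cong wkT (typeOf-ren r x)) (sym (renT-extR-wkT ρ (typeOf Θ x)))
bound-ren (ext<:⇒ᶜ r) zero = refl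
bound-ren (ext<:⇒ᶜ {ρ = ρ} {Θ} r) (suc i) =
  trans (cong wkT (bound-ren r i)) (sym (renT-extR-wkT ρ (bound Θ i)))

ext∶⇒ᶜ : {ρ : Fin n → Fin l} {Θ : Ctx n m} {Θ' : Ctx l m} {A : Ty n} →
         ρ ∶ Θ ⇒ᶜ Θ' → ρ ∶ (Θ ,∶ A) ⇒ᶜ (Θ' ,∶ renT ρ A)
typeOf-ren (ext∶⇒ᶜ r) zero    = refl
typeOf-ren (ext∶⇒ᶜ r) (suc x) = typeOf-ren r x
bound-ren  (ext∶⇒ᶜ r) i       = bound-ren r i

<:-renT : {ρ : Fin n → Fin l} {Θ : Ctx n m} {Θ' : Ctx l m} {A B : Ty n} →
          ρ ∶ Θ ⇒ᶜ Θ' → Θ ⊢ A <: B → Θ' ⊢ renT ρ A <: renT ρ B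
<:-renT {ρ = ρ} {Θ' = Θ'} r (S-Var X) = subst (Θ' ⊢ tvar (ρ X) <:_) (bound-ren r X) (S-Var (ρ X))
<:-renT r S-Top         = S-Top
<:-renT r S-Refl        = S-Refl
<:-renT r (S-Trans p q) = S-Trans (<:-renT r p) (<:-renT r q)
<:-renT r (S-Arrow p q) = S-Arrow (<:-renT r p) (<:-renT r q)
<:-renT r (S-All p)     = S-All (<:-renT (ext<:⇒ᶜ r) p)
<:-renT r S-∧₁          = S-∧₁
<:-renT r S-∧₂          = S-∧₂
<:-renT r (S-∧ p q)     = S-∧ (<:-renT r p) (<:-renT r q)

⊢-renTmT : {ρ : Fin n → Fin l} {Θ : Ctx n m} {Θ' : Ctx l m} {t : Tm n m} {A : Ty n} →
           ρ ∶ Θ ⇒ᶜ Θ' → Θ ⊢ t ∶ A → Θ' ⊢ renTmT ρ t ∶ renT ρ A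
⊢-renTmT r T-Top       = T-Top
⊢-renTmT {Θ' = Θ'} r (T-Var x) = subst (Θ' ⊢ var x ∶_) (typeOf-ren r x) (T-Var x)
⊢-renTmT r (T-Sub d p) = T-Sub (⊢-renTmT r d) (<:-renT r p)
⊢-renTmT r (T-Abs d)   = T-Abs (⊢-renTmT (ext∶⇒ᶜ r) d)
⊢-renTmT r (T-App d e) = T-App (⊢-renTmT r d) (⊢-renTmT r e)
⊢-renTmT r (T-TAbs d)  = T-TAbs (⊢-renTmT (ext<:⇒ᶜ r) d)
⊢-renTmT {ρ = ρ} {Θ' = Θ'} {t = t ⟨ R ⟩} r (T-TApp {T = A} d) =
  subst (Θ' ⊢ renTmT ρ t ⟨ renT ρ R ⟩ ∶_) (renT-[]T ρ A R) (T-TApp (⊢-renTmT r d))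

msubT-mono : {Γ : Ctx n m} {σ₋ σ₊ σ₋' σ₊' : Fin k → Ty n} →
             (∀ i → Γ ⊢ σ₋' i <: σ₋ i) → (∀ i → Γ ⊢ σ₊ i <: σ₊' i) →
             ∀ A → Γ ⊢ msubT σ₋ σ₊ A <: msubT σ₋' σ₊' A
msubT-mono e f ⊤        = S-Refl
msubT-mono e f (tvar i) = f i
msubT-mono e f (A ⇒ B)  = S-Arrow (msubT-mono f e A) (msubT-mono e f B)
msubT-mono {Γ = Γ} e f (∀' A) = S-All (msubT-mono (extS-mono e) (extS-mono f) A)
  where
    extS-mono : {σ σ' : Fin _ → Ty _} → (∀ i → Γ ⊢ σ i <: σ' i) →
                ∀ i → (Γ ,<: ⊤) ⊢ extS σ i <: extS σ' i
    extS-mono e zero    = S-Refl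
    extS-mono e (suc i) = <:-renT (wk⇒ᶜ Γ) (e i)
msubT-mono e f (A ∧ B)  = S-∧ (S-Trans S-∧₁ (msubT-mono e f A)) (S-Trans S-∧₂ (msubT-mono e f B))

module _ (S : Ty n) (T : Ty (suc n)) where

  private
    R : Ty (suc n)
    R = tvar zero ∧ wkT S

  /X⁻-[tvar-zero] : {Γ : Ctx (suc n) m} →
                    Γ ⊢ renT (extR suc) (T [ R /X⁻]) [ tvar zero ]T <: T [ R /X⁻]
  /X⁻-[tvar-zero] {Γ = Γ} =
    subst (Γ ⊢_<: T [ R /X⁻])
          (sym (trans (renT-extR-suc-[]T (T [ R /X⁻]) (tvar zero))
                      (subT-point-tvar-zero (T [ R /X⁻]))))
          S-Refl

  /X⁻-[∧] : {Γ : Ctx (suc n) m} → Γ ⊢ renT (extR suc) (T [ R /X⁻]) [ R ]T <: T [ R /X⁻]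
  /X⁻-[∧] {Γ = Γ} =
    subst (Γ ⊢_<: T [ R /X⁻])
          (sym (trans (renT-extR-suc-[]T (T [ R /X⁻]) R)
                      (subT-msubT (point R) (point R) (point (tvar zero)) T)))
          (msubT-mono negative positive T)
    where
      negative : ∀ i → Γ ⊢ point R i <: subT (point R) (point R i)
      negative zero    = subst (λ Z → Γ ⊢ R <: R ∧ Z) (sym (subT-point-wkT R S)) (S-∧ S-Refl S-∧₂)
      negative (suc i) = S-Refl
      positive : ∀ i → Γ ⊢ subT (point R) (point (tvar zero) i) <: point (tvar zero) i
      positive zero    = S-∧₁
      positive (suc i) = S-Refl

mainTheorem7 : {n m : ℕ} (Θ : Ctx n m) (S : Ty n) (T : Ty (suc n)) (t : Tm n m) →
    Θ ⊢ t ∶ ∀' (T [ tvar zero ∧ wkT S /X⁻]) →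
    Θ ⊢ t ≈ Λ (wkTmT t ⟨ tvar zero ∧ wkT S ⟩) ∶ ∀' (T [ tvar zero ∧ wkT S /X⁻])
mainTheorem7 Θ S T t ⊢t =
  E-Trans (E-Sym (E-η₂ ⊢t))
          (E-TAbs (E-app₂ (E-Refl (⊢-renTmT (wk⇒ᶜ Θ) ⊢t))
                          (/X⁻-[tvar-zero] S T) (/X⁻-[∧] S T)))
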